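{- Let $A$ be a type, $P:A\to\mathbb{B}$ and $t:\mathsf{cotree}\,A$. Then $\mathsf{disjoint}(\mathsf{preimage}\,P\,t)$.
   Context: $\mathsf{cotree}\,X$ is the coinductive type with constructors $\bot$, $\mathsf{coleaf}\,x$, $\mathsf{conode}\,k$ ($k:\mathbb{B}\to\mathsf{cotree}\,X$), ordered coinductively by $\bot\sqsubseteq t$, $\mathsf{coleaf}\,x\sqsubseteq\mathsf{coleaf}\,x$, $\mathsf{conode}\,f\sqsubseteq\mathsf{conode}\,g$ when $f\,b\sqsubseteq g\,b$ for all $b$; order-equivalent cotrees are assumed equal (axiom). $\mathsf{tree}\,X$ is the inductive analogue (constructors $\bot,\mathsf{leaf},\mathsf{node}$); $\mathsf{idl}\,t\,i$ is the depth-$i$ truncation of $t$ (depth $0$ gives $\bot$). For monotone $h:\mathsf{tree}\,X\to C$, $\overline h(t):=\sup_i h(\mathsf{idl}\,t\,i)$ (chosen supremum). $\mathsf{fold}\,z\,f\,g$ on $\mathsf{tree}\,X$: $\bot\mapsto z$, $\mathsf{leaf}\,a\mapsto f\,a$, $\mathsf{node}\,k\mapsto g(\mathsf{fold}\,z\,f\,g\circ k)$. $\mathsf{map}\,h$ replaces each leaf $x$ of a cotree by $h\,x$. $\mathsf{lang}:=\overline{\mathsf{fold}\,\bot\,(\lambda\_.\,\mathsf{coleaf}\,\mathsf{nil})\,(\lambda g.\,\mathsf{conode}(\lambda b.\,\mathsf{map}\,(\mathsf{cons}\,b)\,(g\,b)))}$, $\mathsf{filter}\,P:=\overline{\mathsf{fold}\,\bot\,(\lambda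 a.\,\text{if }P\,a\text{ then }\mathsf{coleaf}\,a\text{ else }\bot)\,\mathsf{conode}}$, and $\mathsf{preimage}\,P:=\mathsf{lang}\circ\mathsf{filter}\,P : \mathsf{cotree}\,A\to\mathsf{cotree}(\mathsf{list}\,\mathbb{B})$. Lists of booleans are ordered by the prefix order; $x\bowtie y$ means $\neg(x\sqsubseteq y\lor y\sqsubseteq x)$. For an ordered type $X$, $\mathsf{disjoint}_{\mathsf{tree}}:\mathsf{tree}\,X\to\mathbb{P}$ is the inductive predicate: it holds of $\bot$ and of every $\mathsf{leaf}\,x$, and of $\mathsf{node}\,k$ whenever $\mathsf{disjoint}_{\mathsf{tree}}(k\,b)$ for both $b$ and every leaf value $x$ of $k\,\mathbf{true}$ and every leaf value $y$ of $k\,\mathbf{false}$ satisfy $x\bowtie y$. For $t:\mathsf{cotree}\,X$, $\mathsf{disjoint}\,t :\iff \forall i,\ \mathsf{disjoint}_{\mathsf{tree}}(\mathsf{idl}\,t\,i)$. -}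

module Defs where

open import Level using (Level)
open import Data.Bool using (Bool; true; false; if_then_else_)
open import Data.Nat using (ℕ; zero; suc)
open import Data.List using (List; []; _∷_)
open import Data.Product using (_×_)
open import Data.Sum using (_⊎_)
open import Relation.Nullary using (¬_)
open import Relation.Binary.PropositionalEquality using (_≡_)
open import Data.List.Relation.Binary.Prefix.Heterogeneous using (Prefix)

private variable
  ℓ ℓ' : Level
  X Y : Set ℓ

data tree (X : Set ℓ) : Set ℓ where
  bot  : tree X
  leaf : X → tree X
  node : (Bool → tree X) → tree X

fold : {C : Set ℓ'} → C → (X → C) → ((Bool → C) → C) → tree X → C
fold z f g bot      = z
fold z f g (leaf a) = f a
fold z f g (node k) = g (λ b → fold z f g (k b))

-- Positions below a non-node are never inspected (junk).

data Shape (X : Set ℓ) : Set ℓ where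
  sbot  : Shape X
  sleaf : X → Shape X
  snode : Shape X

cotree : Set ℓ → Set ℓ
cotree X = List Bool → Shape X

cobot : cotree X
cobot _ = sbot

coleaf : X → cotree X
coleaf x []      = sleaf x
coleaf x (_ ∷ _) = sbot

conode : (Bool → cotree X) → cotree X
conode k []      = snode
conode k (b ∷ p) = k b p

child : cotree X → Bool → cotree X
child t b p = t (b ∷ p)

data Reach {X : Set ℓ} (t : cotree X) : List Bool → Set ℓ where
  root : Reach t []
  step : ∀ {b p} → t [] ≡ snode → Reach (child t b) p → Reach t (b ∷ p)

data _⊑S_ {X : Set ℓ} : Shape X → Shape X → Set ℓ where
  bot⊑  : ∀ {s} → sbot ⊑S s
  leaf⊑ : ∀ {x} → sleaf x ⊑S sleaf x
  node⊑ : snode ⊑S snode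

-- the coinductive order on cotrees, unfolded: every position of s
-- (reached through nodes) is related to the same position of t
_⊑_ : {X : Set ℓ} → cotree X → cotree X → Set ℓ
s ⊑ t = ∀ p → Reach s p → s p ⊑S t p

idl : cotree X → ℕ → tree X
idl t zero = bot
idl t (suc i) with t []
... | sbot    = bot
... | sleaf x = leaf x
... | snode   = node (λ b → idl (child t b) i)

mapShape : (X → Y) → Shape X → Shape Y
mapShape h sbot      = sbot
mapShape h (sleaf x) = sleaf (h x)
mapShape h snode     = snode

map : (X → Y) → cotree X → cotree Y
map h t p = mapShape h (t p)

IsSup : (ℕ → cotree X) → cotree X → Set _
IsSup c s = (∀ i → c i ⊑ s) × (∀ u → (∀ i → c i ⊑ u) → s ⊑ u)

-- the algebras whose continuous extensions are lang and filter P
langAlg : tree X → cotree (List Bool)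
langAlg = fold cobot (λ _ → coleaf []) (λ g → conode (λ b → map (b ∷_) (g b)))

filterAlg : (X → Bool) → tree X → cotree X
filterAlg P = fold cobot (λ a → if P a then coleaf a else cobot) conode

_≼_ : List Bool → List Bool → Set
_≼_ = Prefix _≡_

_⋈_ : {X : Set ℓ} → (X → X → Set ℓ') → X → X → Set ℓ'
(_≤_ ⋈ x) y = ¬ (x ≤ y ⊎ y ≤ x)

data LeafOf {X : Set ℓ} : X → tree X → Set ℓ where
  here  : ∀ {x} → LeafOf x (leaf x)
  there : ∀ {x k} b → LeafOf x (k b) → LeafOf x (node k)

data disjoint-tree {X : Set ℓ} (_≤_ : X → X → Set ℓ') : tree X → Set (ℓ Level.⊔ ℓ') where
  dbot  : disjoint-tree _≤_ bot
  dleaf : ∀ x → disjoint-tree _≤_ (leaf x)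
  dnode : ∀ {k} → (∀ b → disjoint-tree _≤_ (k b))
        → (∀ x y → LeafOf x (k true) → LeafOf y (k false) → (_≤_ ⋈ x) y)
        → disjoint-tree _≤_ (node k)

disjoint : {X : Set ℓ} (_≤_ : X → X → Set ℓ') → cotree X → Set (ℓ Level.⊔ ℓ')
disjoint _≤_ t = ∀ i → disjoint-tree _≤_ (idl t i)

-- Every leaf of the finite approximation langAlg τ carries its own position
-- as its value. Relabelling each leaf of the supremum by its position gives
-- another upper bound of the chain, so by leastness the supremum's leaves
-- are labelled by their positions too. Leaves below different children of a
-- node then sit at paths q ++ true ∷ p and q ++ false ∷ p', which are
-- incomparable in the prefix order.
module Submission where

open import Defs
open import Data.Bool using (Bool; true; false)
open import Data.List using (List; []; _∷_; _++_; [_])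
open import Data.List.Properties using (++-assoc)
open import Data.List.Relation.Binary.Prefix.Heterogeneous using (_∷_)
open import Data.List.Relation.Binary.Prefix.Heterogeneous.Properties using (++⁻)
open import Data.Nat using (ℕ; zero; suc)
open import Data.Product using (Σ-syntax; _×_; _,_)
open import Data.Sum using (inj₁; inj₂)
open import Level using (Level)
open import Relation.Binary.PropositionalEquality using (_≡_; refl; trans; sym; cong)

private variable
  ℓ : Level
  X : Set ℓ

PositionLabelled : List Bool → cotree (List Bool) → Set
PositionLabelled q s = ∀ p x → Reach s p → s p ≡ sleaf x → x ≡ q ++ p

langAlg-leaf≡position : (τ : tree X) → ∀ p x → langAlg τ p ≡ sleaf x → x ≡ p
langAlg-leaf≡position (leaf a) [] x refl = refl
langAlg-leaf≡position (node k) (b ∷ p) x eq with langAlg (k b) p in eq′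
langAlg-leaf≡position (node k) (b ∷ p) x refl | sleaf y =
  cong (b ∷_) (langAlg-leaf≡position (k b) p y eq′)

labelShape : List Bool → Shape (List Bool) → Shape (List Bool)
labelShape p sbot      = sbot
labelShape p (sleaf _) = sleaf p
labelShape p snode     = snode

relabelByPosition : cotree (List Bool) → cotree (List Bool)
relabelByPosition s p = labelShape p (s p)

⊑S-labelShape : ∀ {a b : Shape (List Bool)} p → a ⊑S b
              → (∀ x → a ≡ sleaf x → x ≡ p) → a ⊑S labelShape p b
⊑S-labelShape p bot⊑         _      = bot⊑
⊑S-labelShape p (leaf⊑ {x}) labelled with labelled x refl
... | refl = leaf⊑
⊑S-labelShape p node⊑        _      = node⊑

⊑S-labelShape⇒leaf≡position : ∀ (a : Shape (List Bool)) p x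
                            → a ⊑S labelShape p a → a ≡ sleaf x → x ≡ p
⊑S-labelShape⇒leaf≡position (sleaf _) _ _ leaf⊑ refl = refl

sup-langAlg-positionLabelled : (τ : ℕ → tree X) (s : cotree (List Bool))
                             → IsSup (λ i → langAlg (τ i)) s → PositionLabelled [] s
sup-langAlg-positionLabelled τ s (upper , least) p x r =
  ⊑S-labelShape⇒leaf≡position (s p) p x (least (relabelByPosition s) relabelledUpper p r)
  where
  relabelledUpper : ∀ i → langAlg (τ i) ⊑ relabelByPosition s
  relabelledUpper i p r = ⊑S-labelShape p (upper i p r) (langAlg-leaf≡position (τ i) p)

leafOf-idl⇒reachableLeaf : (s : cotree X) (i : ℕ) (x : X) → LeafOf x (idl s i)
                         → Σ[ p ∈ List Bool ] Reach s p × s p ≡ sleaf x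
leafOf-idl⇒reachableLeaf s (suc i) x l with s [] in eq
leafOf-idl⇒reachableLeaf s (suc i) x here        | sleaf .x = [] , root , eq
leafOf-idl⇒reachableLeaf s (suc i) x (there b l) | snode
  with leafOf-idl⇒reachableLeaf (child s b) i x l
... | p , r , e = b ∷ p , step eq r , e

branch-⋈ : ∀ q p p′ → (_≼_ ⋈ (q ++ true ∷ p)) (q ++ false ∷ p′)
branch-⋈ q p p′ (inj₁ pre) with ++⁻ {as = q} {ds = false ∷ p′} refl pre
... | () ∷ _
branch-⋈ q p p′ (inj₂ pre) with ++⁻ {as = q} {ds = true ∷ p} refl pre
... | () ∷ _

positionLabelled⇒disjoint : ∀ q (s : cotree (List Bool))
                          → PositionLabelled q s → disjoint _≼_ s
positionLabelled⇒disjoint q s labelled zero = dbot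
positionLabelled⇒disjoint q s labelled (suc i) with s [] in eq
... | sbot    = dbot
... | sleaf x = dleaf x
... | snode   = dnode (λ b → positionLabelled⇒disjoint (q ++ [ b ]) (child s b) (childLabelled b) i)
                      branchesIncomparable
  where
  childLabelled : ∀ b → PositionLabelled (q ++ [ b ]) (child s b)
  childLabelled b p x r e = trans (labelled (b ∷ p) x (step eq r) e) (sym (++-assoc q [ b ] p))

  branchesIncomparable : ∀ x y → LeafOf x (idl (child s true) i) → LeafOf y (idl (child s false) i)
                       → (_≼_ ⋈ x) y
  branchesIncomparable x y lx ly
    with leafOf-idl⇒reachableLeaf (child s true) i x lx | leafOf-idl⇒reachableLeaf (child s false) i y ly
  ... | p , r , e | p′ , r′ , e′
    with labelled (true ∷ p) x (step eq r) e | labelled (false ∷ p′) y (step eq r′) e′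
  ... | refl | refl = branch-⋈ q p p′

mainTheorem3 : {ℓ : Level} {A : Set ℓ} (P : A → Bool) (t : cotree A)
    → (ft : cotree A) → IsSup (λ i → filterAlg P (idl t i)) ft
    → (pt : cotree (List Bool)) → IsSup (λ i → langAlg (idl ft i)) pt
    → disjoint _≼_ pt
mainTheorem3 P t ft _ pt ptSup =
  positionLabelled⇒disjoint [] pt (sup-langAlg-positionLabelled (idl ft) pt ptSup)
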